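{- Let $\Sigma,\Gamma$ be alphabets. The assignment $\mathcal A\mapsto\exists_\Gamma\mathcal A$ extends to a functor $\mathbf{Aut}_{\Sigma\times\Gamma}\to\mathbf{Aut}_\Sigma$ which is left adjoint to the weakening functor $(-)[\pi]:\mathbf{Aut}_\Sigma\to\mathbf{Aut}_{\Sigma\times\Gamma}$.
   Context: An alphabet is a finite nonempty set. A uniform automaton over $\Sigma$ is $\mathcal A=(Q_{\mathcal A},q_0,M(\mathcal A),\partial_{\mathcal A},\Omega_{\mathcal A})$ with $Q_{\mathcal A}$ finite, $M(\mathcal A)$ a finite nonempty set of moves, $\partial_{\mathcal A}:Q_{\mathcal A}\times\Sigma\times M(\mathcal A)\to Q_{\mathcal A}$, $\Omega_{\mathcal A}\subseteq Q_{\mathcal A}^\omega$ $\omega$-regular; $R\in M(\mathcal A)^\omega$ is an accepting run on $\sigma$ ($R\Vdash\mathcal A(\sigma)$) if the sequence $q_0$, $q_{k+1}=\partial_{\mathcal A}(q_k,\sigma(k),R(k))$ lies in $\Omega_{\mathcal A}$. Finite-state synchronous functions are those induced by deterministic Mealy machines; streams over product alphabets are identified with tuples of streams. $\mathbf{Aut}_\Sigma$ has uniform automata over $\Sigma$ as objects; morphisms $\mathcal A\to\mathcal B$ are finite-state synchronous $F:(\Sigma\times M(\mathcal A))^\omega\to M(\mathcal B)^\omega$ with $F(\sigma,R)\Vdash\mathcal B(\sigma)$ whenever $R\Vdash\mathcal A(\sigma)$; identity $(\sigma,R)\mapsto R$, composition $(G\circ F)(\sigma,R)=G(\sigma,F(\sigma,R))$.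 For $\mathcal A$ over $\Sigma\times\Gamma$, $\exists_\Gamma\mathcal A:=(Q_{\mathcal A},q_0,\Gamma\times M(\mathcal A),\partial,\Omega_{\mathcal A})$ over $\Sigma$ with $\partial(q,a,(b,u))=\partial_{\mathcal A}(q,(a,b),u)$. The weakening functor sends $\mathcal B$ over $\Sigma$ to $\mathcal B[\pi]$ over $\Sigma\times\Gamma$, identical to $\mathcal B$ but with transitions $(q,(a,b),u)\mapsto\partial_{\mathcal B}(q,a,u)$, and a morphism $F:\mathcal B\to\mathcal B'$ to $F[\pi]:((\sigma,\tau),R)\mapsto F(\sigma,R)$. -}

module Defs where

open import Data.Nat using (ℕ; zero; suc; _≤_; _*_)
open import Data.Fin using (Fin)
open import Data.Fin.Properties using (*↔×)
open import Data.Bool using (Bool; T)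
open import Data.Product using (Σ; Σ-syntax; _×_; _,_; proj₁; proj₂)
open import Function using (_∘_; _↔_)
open import Function.Properties.Inverse using (↔-refl; ↔-sym; ↔-trans)
open import Data.Product.Function.NonDependent.Propositional using (_×-↔_)
open import Relation.Binary.PropositionalEquality
  using (_≡_; refl; sym; trans; cong; cong₂; subst)

Stream : Set → Set
Stream A = ℕ → A

IsFinite : Set → Set
IsFinite A = Σ ℕ (λ n → A ↔ Fin n)

finite-× : {A B : Set} → IsFinite A → IsFinite B → IsFinite (A × B)
finite-× (n , a) (m , b) = n * m , ↔-trans (a ×-↔ b) (↔-sym *↔×)

record Alphabet : Set₁ where
  field
    Carrier  : Set
    finite   : IsFinite Carrier
    nonempty : Carrier
open Alphabet public

_⊗_ : Alphabet → Alphabet → Alphabet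
Σ₁ ⊗ Γ₁ = record
  { Carrier  = Carrier Σ₁ × Carrier Γ₁
  ; finite   = finite-× (finite Σ₁) (finite Γ₁)
  ; nonempty = nonempty Σ₁ , nonempty Γ₁ }

record Buchi (Q : Set) : Set where
  field
    size  : ℕ
    init  : Fin size → Bool
    step  : Fin size → Q → Fin size → Bool
    acc   : Fin size → Bool
open Buchi public

Accepts : {Q : Set} → Buchi Q → Stream Q → Set
Accepts B w =
  Σ (Stream (Fin (size B))) λ ρ →
    T (init B (ρ 0)) ×
    ((k : ℕ) → T (step B (ρ k) (w k) (ρ (suc k)))) ×
    ((k : ℕ) → Σ ℕ λ j → k ≤ j × T (acc B (ρ j)))

Accepts-ext : {Q : Set} (B : Buchi Q) {w w' : Stream Q} →
  ((k : ℕ) → w k ≡ w' k) → Accepts B w → Accepts B w'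
Accepts-ext B {w} {w'} e (ρ , i , t , a) =
  ρ , i , (λ k → subst (λ x → T (step B (ρ k) x (ρ (suc k)))) (e k) (t k)) , a

record UAut (Σ₀ : Alphabet) : Set₁ where
  field
    Q     : Set
    Q-fin : IsFinite Q
    q₀    : Q
    M     : Set
    M-fin : IsFinite M
    M-ne  : M
    ∂     : Q → Carrier Σ₀ → M → Q
    Ω     : Buchi Q        -- Ω_A ⊆ Q^ω is the (ω-regular) language of this automaton
open UAut public

states : {Σ₀ : Alphabet} (A : UAut Σ₀) → Stream (Carrier Σ₀) → Stream (M A) → Stream (Q A)
states A σ R zero    = q₀ A
states A σ R (suc k) = ∂ A (states A σ R k) (σ k) (R k)

-- Accepting A σ R  means  R ⊩ A(σ)
Accepting : {Σ₀ : Alphabet} (A : UAut Σ₀) → Stream (Carrier Σ₀) → Stream (M A) → Set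
Accepting A σ R = Accepts (Ω A) (states A σ R)

record Mealy (I O : Set) : Set₁ where
  field
    S     : Set
    S-fin : IsFinite S
    s₀    : S
    δ     : S → I → S × O
open Mealy public

mstate : {I O : Set} (m : Mealy I O) → Stream I → Stream (S m)
mstate m w zero    = s₀ m
mstate m w (suc k) = proj₁ (δ m (mstate m w k) (w k))

mout : {I O : Set} (m : Mealy I O) → Stream I → Stream O
mout m w k = proj₂ (δ m (mstate m w k) (w k))

IsFiniteState : {I O : Set} → (Stream I → Stream O) → Set₁
IsFiniteState {I} {O} F = Σ (Mealy I O) λ m → (w : Stream I) (k : ℕ) → F w k ≡ mout m w k

record CatData : Set₂ where
  field
    Obj : Set₁
    Hom : Obj → Obj → Set₁
    _≈_ : {A B : Obj} → Hom A B → Hom A B → Set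
    id  : (A : Obj) → Hom A A
    _⊚_ : {A B C : Obj} → Hom B C → Hom A B → Hom A C

record FunctorOn (C D : CatData) (F₀ : CatData.Obj C → CatData.Obj D) : Set₂ where
  module C = CatData C
  module D = CatData D
  field
    F₁     : {A B : C.Obj} → C.Hom A B → D.Hom (F₀ A) (F₀ B)
    F-resp : {A B : C.Obj} {f g : C.Hom A B} → f C.≈ g → F₁ f D.≈ F₁ g
    F-id   : (A : C.Obj) → F₁ (C.id A) D.≈ D.id (F₀ A)
    F-∘    : {A B E : C.Obj} (g : C.Hom B E) (f : C.Hom A B) →
             F₁ (g C.⊚ f) D.≈ (F₁ g D.⊚ F₁ f)

record Adjunction {C D : CatData} {L₀ : CatData.Obj C → CatData.Obj D}
                  {R₀ : CatData.Obj D → CatData.Obj C}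
                  (L : FunctorOn C D L₀) (R : FunctorOn D C R₀) : Set₂ where
  module C = CatData C
  module D = CatData D
  field
    φ      : {A : C.Obj} {B : D.Obj} → D.Hom (L₀ A) B → C.Hom A (R₀ B)
    ψ      : {A : C.Obj} {B : D.Obj} → C.Hom A (R₀ B) → D.Hom (L₀ A) B
    φ-resp : {A : C.Obj} {B : D.Obj} {f g : D.Hom (L₀ A) B} → f D.≈ g → φ f C.≈ φ g
    ψ-resp : {A : C.Obj} {B : D.Obj} {f g : C.Hom A (R₀ B)} → f C.≈ g → ψ f D.≈ ψ g
    ψφ     : {A : C.Obj} {B : D.Obj} (f : D.Hom (L₀ A) B) → ψ (φ f) D.≈ f
    φψ     : {A : C.Obj} {B : D.Obj} (g : C.Hom A (R₀ B)) → φ (ψ g) C.≈ g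
    nat-B  : {A : C.Obj} {B B' : D.Obj} (g : D.Hom B B') (f : D.Hom (L₀ A) B) →
             φ (g D.⊚ f) C.≈ (FunctorOn.F₁ R g C.⊚ φ f)
    nat-A  : {A A' : C.Obj} {B : D.Obj} (f : D.Hom (L₀ A) B) (h : C.Hom A' A) →
             φ (f D.⊚ FunctorOn.F₁ L h) C.≈ (φ f C.⊚ h)

module _ {Σ₀ : Alphabet} where

  record AutHom (A B : UAut Σ₀) : Set₁ where
    field
      fun   : Stream (Carrier Σ₀) → Stream (M A) → Stream (M B)
      fs    : IsFiniteState {Carrier Σ₀ × M A} {M B} (λ w → fun (proj₁ ∘ w) (proj₂ ∘ w))
      sound : (σ : Stream (Carrier Σ₀)) (R : Stream (M A)) →
              Accepting A σ R → Accepting B σ (fun σ R)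
  open AutHom public

  _≈H_ : {A B : UAut Σ₀} → AutHom A B → AutHom A B → Set
  F ≈H G = ∀ σ R (k : ℕ) → fun F σ R k ≡ fun G σ R k

  mstate-ext : {I O : Set} (m : Mealy I O) {w w' : Stream I} →
    (∀ k → w k ≡ w' k) → ∀ k → mstate m w k ≡ mstate m w' k
  mstate-ext m e zero = refl
  mstate-ext m e (suc k) = cong₂ (λ s i → proj₁ (δ m s i)) (mstate-ext m e k) (e k)

  mout-ext : {I O : Set} (m : Mealy I O) {w w' : Stream I} →
    (∀ k → w k ≡ w' k) → ∀ k → mout m w k ≡ mout m w' k
  mout-ext m e k = cong₂ (λ s i → proj₂ (δ m s i)) (mstate-ext m e k) (e k)

  idMealy : (I : Set) → Mealy (Carrier Σ₀ × I) I
  idMealy I = record { S = Fin 1 ; S-fin = 1 , ↔-refl ; s₀ = Fin.zero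
                     ; δ = λ s i → s , proj₂ i }

  idH : (A : UAut Σ₀) → AutHom A A
  idH A = record { fun = λ σ R → R ; fs = idMealy (M A) , (λ w k → refl)
                 ; sound = λ σ R r → r }

  seqMealy : {I O P : Set} → Mealy (Carrier Σ₀ × I) O → Mealy (Carrier Σ₀ × O) P →
             Mealy (Carrier Σ₀ × I) P
  seqMealy mF mG = record
    { S = S mF × S mG ; S-fin = finite-× (S-fin mF) (S-fin mG) ; s₀ = s₀ mF , s₀ mG
    ; δ = λ st i →
        (proj₁ (δ mF (proj₁ st) i) ,
         proj₁ (δ mG (proj₂ st) (proj₁ i , proj₂ (δ mF (proj₁ st) i)))) ,
        proj₂ (δ mG (proj₂ st) (proj₁ i , proj₂ (δ mF (proj₁ st) i))) }

  seq-state : {I O P : Set} (mF : Mealy (Carrier Σ₀ × I) O) (mG : Mealy (Carrier Σ₀ × O) P)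
    (w : Stream (Carrier Σ₀ × I)) → ∀ k →
    mstate (seqMealy mF mG) w k ≡ (mstate mF w k , mstate mG (λ j → proj₁ (w j) , mout mF w j) k)
  seq-state mF mG w zero = refl
  seq-state mF mG w (suc k) rewrite seq-state mF mG w k = refl

  seq-out : {I O P : Set} (mF : Mealy (Carrier Σ₀ × I) O) (mG : Mealy (Carrier Σ₀ × O) P)
    (w : Stream (Carrier Σ₀ × I)) → ∀ k →
    mout (seqMealy mF mG) w k ≡ mout mG (λ j → proj₁ (w j) , mout mF w j) k
  seq-out mF mG w k rewrite seq-state mF mG w k = refl

  _∘H_ : {A B C : UAut Σ₀} → AutHom B C → AutHom A B → AutHom A C
  _∘H_ {A} {B} {C} G F = record
    { fun = λ σ R → fun G σ (fun F σ R)
    ; fs = seqMealy mF mG , λ w k →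
        trans (proj₂ (fs G) (λ j → proj₁ (w j) , fun F (proj₁ ∘ w) (proj₂ ∘ w) j) k)
        (trans (mout-ext mG (λ j → cong (proj₁ (w j) ,_) (proj₂ (fs F) w j)) k)
               (sym (seq-out mF mG w k)))
    ; sound = λ σ R r → sound G σ (fun F σ R) (sound F σ R r) }
    where
    mF = proj₁ (fs F)
    mG = proj₁ (fs G)

Aut : Alphabet → CatData
Aut Σ₀ = record { Obj = UAut Σ₀ ; Hom = AutHom ; _≈_ = _≈H_ ; id = idH ; _⊚_ = _∘H_ }

∃[_,_] : (Σ₀ Γ₀ : Alphabet) → UAut (Σ₀ ⊗ Γ₀) → UAut Σ₀
∃[ Σ₀ , Γ₀ ] A = record
  { Q = Q A ; Q-fin = Q-fin A ; q₀ = q₀ A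
  ; M = Carrier Γ₀ × M A ; M-fin = finite-× (finite Γ₀) (M-fin A)
  ; M-ne = nonempty Γ₀ , M-ne A
  ; ∂ = λ q a bu → ∂ A q (a , proj₁ bu) (proj₂ bu)
  ; Ω = Ω A }

module _ (Σ₀ Γ₀ : Alphabet) where

  _[π] : UAut Σ₀ → UAut (Σ₀ ⊗ Γ₀)
  B [π] = record
    { Q = Q B ; Q-fin = Q-fin B ; q₀ = q₀ B ; M = M B ; M-fin = M-fin B ; M-ne = M-ne B
    ; ∂ = λ q ab u → ∂ B q (proj₁ ab) u ; Ω = Ω B }

  states-π : (B : UAut Σ₀) (w : Stream (Carrier Σ₀ × Carrier Γ₀)) (R : Stream (M B)) →
    ∀ k → states (B [π]) w R k ≡ states B (proj₁ ∘ w) R k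
  states-π B w R zero = refl
  states-π B w R (suc k) = cong (λ q → ∂ B q (proj₁ (w k)) (R k)) (states-π B w R k)

  premap : {I J O : Set} → (J → I) → Mealy I O → Mealy J O
  premap f m = record { S = S m ; S-fin = S-fin m ; s₀ = s₀ m ; δ = λ s j → δ m s (f j) }

  premap-state : {I J O : Set} (f : J → I) (m : Mealy I O) (w : Stream J) →
    ∀ k → mstate (premap f m) w k ≡ mstate m (f ∘ w) k
  premap-state f m w zero = refl
  premap-state f m w (suc k) = cong (λ s → proj₁ (δ m s (f (w k)))) (premap-state f m w k)

  premap-out : {I J O : Set} (f : J → I) (m : Mealy I O) (w : Stream J) →
    ∀ k → mout (premap f m) w k ≡ mout m (f ∘ w) k
  premap-out f m w k = cong (λ s → proj₂ (δ m s (f (w k)))) (premap-state f m w k)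

  weakHom : {B B' : UAut Σ₀} → AutHom B B' → AutHom (B [π]) (B' [π])
  weakHom {B} {B'} F = record
    { fun = λ w R → fun F (proj₁ ∘ w) R
    ; fs = premap (λ i → proj₁ (proj₁ i) , proj₂ i) (proj₁ (fs F)) , λ w k →
        trans (proj₂ (fs F) (λ j → proj₁ (proj₁ (w j)) , proj₂ (w j)) k)
              (sym (premap-out (λ i → proj₁ (proj₁ i) , proj₂ i) (proj₁ (fs F)) w k))
    ; sound = λ w R r →
        Accepts-ext (Ω B') (λ k → sym (states-π B' w (fun F (proj₁ ∘ w) R) k))
          (sound F (proj₁ ∘ w) R (Accepts-ext (Ω B) (states-π B w R) r)) }

  Weakening : FunctorOn (Aut Σ₀) (Aut (Σ₀ ⊗ Γ₀)) _[π]
  Weakening = record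
    { F₁ = weakHom
    ; F-resp = λ e w R k → e (proj₁ ∘ w) R k
    ; F-id = λ A w R k → refl
    ; F-∘ = λ g f w R k → refl }

-- A move of ∃_Γ A is a Γ-letter paired with a move of A. So a morphism ∃_Γ A → B reads the
-- Γ-stream as part of its run, while a morphism A → B[π] reads it as part of its input.
-- Transposition merely moves the Γ-stream from one side to the other; since ∃_Γ A and B[π]
-- compute exactly the state sequences of A and B, acceptance is preserved, and all the
-- adjunction laws hold definitionally.
module Submission where

open import Defs
open import Data.Product using (Σ-syntax; _×_; _,_; proj₁; proj₂; map₂; assocˡ′; assocʳ′)
open import Data.Nat using (zero; suc)
open import Function using (_∘_; id; _⇔_; mk⇔; Equivalence)
open import Relation.Binary.PropositionalEquality using (_≡_; refl; sym; trans; cong)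

mapMealy : {I J O P : Set} → (J → I) → (J → O → P) → Mealy I O → Mealy J P
mapMealy f g m = record
  { S = S m ; S-fin = S-fin m ; s₀ = s₀ m ; δ = λ s j → map₂ (g j) (δ m s (f j)) }

mstate-mapMealy : {I J O P : Set} (f : J → I) (g : J → O → P) (m : Mealy I O)
  (w : Stream J) → ∀ k → mstate (mapMealy f g m) w k ≡ mstate m (f ∘ w) k
mstate-mapMealy f g m w zero    = refl
mstate-mapMealy f g m w (suc k) =
  cong (λ s → proj₁ (δ m s (f (w k)))) (mstate-mapMealy f g m w k)

mout-mapMealy : {I J O P : Set} (f : J → I) (g : J → O → P) (m : Mealy I O)
  (w : Stream J) → ∀ k → mout (mapMealy f g m) w k ≡ g (w k) (mout m (f ∘ w) k)
mout-mapMealy f g m w k =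
  cong (λ s → g (w k) (proj₂ (δ m s (f (w k))))) (mstate-mapMealy f g m w k)

isFiniteState-relabel : {I J O P : Set} (f : J → I) (g : J → O → P)
  {F : Stream I → Stream O} {G : Stream J → Stream P} → IsFiniteState F →
  (∀ w k → G w k ≡ g (w k) (F (f ∘ w) k)) → IsFiniteState G
isFiniteState-relabel f g (m , F≡m) G≡ =
  mapMealy f g m , λ w k →
    trans (G≡ w k) (trans (cong (g (w k)) (F≡m (f ∘ w) k)) (sym (mout-mapMealy f g m w k)))

module _ (Σ₀ Γ₀ : Alphabet) where
  private
    ∃Γ : UAut (Σ₀ ⊗ Γ₀) → UAut Σ₀
    ∃Γ = ∃[ Σ₀ , Γ₀ ]

    _[π]′ : UAut Σ₀ → UAut (Σ₀ ⊗ Γ₀)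
    _[π]′ = (Σ₀ [π]) Γ₀

    zip : {A B : Set} → Stream A → Stream B → Stream (A × B)
    zip σ τ k = σ k , τ k

  states-∃ : (A : UAut (Σ₀ ⊗ Γ₀)) (σ : Stream (Carrier Σ₀)) (TR : Stream (Carrier Γ₀ × M A)) →
    ∀ k → states (∃Γ A) σ TR k ≡ states A (zip σ (proj₁ ∘ TR)) (proj₂ ∘ TR) k
  states-∃ A σ TR zero    = refl
  states-∃ A σ TR (suc k) =
    cong (λ q → ∂ A q (σ k , proj₁ (TR k)) (proj₂ (TR k))) (states-∃ A σ TR k)

  accepting-∃⇔ : (A : UAut (Σ₀ ⊗ Γ₀)) (σ : Stream (Carrier Σ₀)) (TR : Stream (Carrier Γ₀ × M A)) →
    Accepting (∃Γ A) σ TR ⇔ Accepting A (zip σ (proj₁ ∘ TR)) (proj₂ ∘ TR)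
  accepting-∃⇔ A σ TR = mk⇔
    (Accepts-ext (Ω A) (states-∃ A σ TR))
    (Accepts-ext (Ω A) (sym ∘ states-∃ A σ TR))

  accepting-π⇔ : (B : UAut Σ₀) (w : Stream (Carrier Σ₀ × Carrier Γ₀)) (R : Stream (M B)) →
    Accepting (B [π]′) w R ⇔ Accepting B (proj₁ ∘ w) R
  accepting-π⇔ B w R = mk⇔
    (Accepts-ext (Ω B) (states-π Σ₀ Γ₀ B w R))
    (Accepts-ext (Ω B) (sym ∘ states-π Σ₀ Γ₀ B w R))

  ∃-map : {A B : UAut (Σ₀ ⊗ Γ₀)} → AutHom A B → AutHom (∃Γ A) (∃Γ B)
  ∃-map {A} {B} F = record
    { fun   = λ σ TR k → proj₁ (TR k) , fun F (zip σ (proj₁ ∘ TR)) (proj₂ ∘ TR) k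
    ; fs    = isFiniteState-relabel assocˡ′ (λ i → proj₁ (proj₂ i) ,_) (fs F) (λ w k → refl)
    ; sound = λ σ TR →
        Equivalence.from (accepting-∃⇔ B σ _)
        ∘ sound F _ (proj₂ ∘ TR)
        ∘ Equivalence.to (accepting-∃⇔ A σ TR) }

  ∃-functor : FunctorOn (Aut (Σ₀ ⊗ Γ₀)) (Aut Σ₀) ∃Γ
  ∃-functor = record
    { F₁     = ∃-map
    ; F-resp = λ F≈G σ TR k → cong (proj₁ (TR k) ,_) (F≈G _ (proj₂ ∘ TR) k)
    ; F-id   = λ A σ TR k → refl
    ; F-∘    = λ G F σ TR k → refl }

  ladjunct : {A : UAut (Σ₀ ⊗ Γ₀)} {B : UAut Σ₀} → AutHom (∃Γ A) B → AutHom A (B [π]′)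
  ladjunct {A} {B} F = record
    { fun   = λ w R → fun F (proj₁ ∘ w) (zip (proj₂ ∘ w) R)
    ; fs    = isFiniteState-relabel assocʳ′ (λ _ → id) (fs F) (λ w k → refl)
    ; sound = λ w R →
        Equivalence.from (accepting-π⇔ B w _)
        ∘ sound F (proj₁ ∘ w) _
        ∘ Equivalence.from (accepting-∃⇔ A (proj₁ ∘ w) (zip (proj₂ ∘ w) R)) }

  radjunct : {A : UAut (Σ₀ ⊗ Γ₀)} {B : UAut Σ₀} → AutHom A (B [π]′) → AutHom (∃Γ A) B
  radjunct {A} {B} G = record
    { fun   = λ σ TR → fun G (zip σ (proj₁ ∘ TR)) (proj₂ ∘ TR)
    ; fs    = isFiniteState-relabel assocˡ′ (λ _ → id) (fs G) (λ w k → refl)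
    ; sound = λ σ TR →
        Equivalence.to (accepting-π⇔ B _ _)
        ∘ sound G _ (proj₂ ∘ TR)
        ∘ Equivalence.to (accepting-∃⇔ A σ TR) }

proposition6p3 : (Σ₀ Γ₀ : Alphabet) →
    Σ[ E ∈ FunctorOn (Aut (Σ₀ ⊗ Γ₀)) (Aut Σ₀) ∃[ Σ₀ , Γ₀ ] ] Adjunction E (Weakening Σ₀ Γ₀)
proposition6p3 Σ₀ Γ₀ = ∃-functor Σ₀ Γ₀ , record
  { φ      = ladjunct Σ₀ Γ₀
  ; ψ      = radjunct Σ₀ Γ₀
  ; φ-resp = λ F≈G w R k → F≈G _ _ k
  ; ψ-resp = λ F≈G σ TR k → F≈G _ _ k
  ; ψφ     = λ F σ TR k → refl
  ; φψ     = λ G w R k → refl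
  ; nat-B  = λ G F w R k → refl
  ; nat-A  = λ F H w R k → refl }
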